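{- Let $p>3$ be a prime, let $a$ be a positive integer with $\gcd(a,p)=1$, and let $r\ge 0$, $m\ge 1$ be integers. Let $b_{2,r,a,m}(n)$ denote the number of partitions of $n$ in which every multiplicity $\mu$ of a part satisfies: either $\mu\equiv 0\pmod p$ and $0\le \mu\le p(m-1)$, or $\mu\equiv a\pmod p$ and $pr+a\le\mu\le pr+a+p(m-1)$. Let $t$ be an integer such that $24ta^{ -1}+1$ is a quadratic nonresidue modulo $p$, where $a^{ -1}$ denotes the inverse of $a$ modulo $p$. Then $$b_{2,r,a,m}(pn+t)\equiv 0\pmod 2\quad\text{for all } n\ge 0.$$
   Context: A partition of $n$ is a finite multiset of positive integers (parts) summing to $n$; the multiplicity of a part is the number of times it occurs. -}

module Defs where

open import Data.Nat as ℕ using (ℕ; zero; suc; _+_; _*_; _∸_; _≤_; _≤?_; _%_)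
open import Data.Nat.Properties as ℕP using ()
open import Data.Integer as ℤ using (ℤ; +_; -[1+_])
open import Data.List using (List; []; _∷_; [_]; _++_; map; concatMap; filter; upTo; replicate; length)
open import Data.List.Relation.Unary.All using (All; all?)
open import Data.Product using (_×_; _,_)
open import Data.Sum using (_⊎_)
open import Relation.Nullary using (Dec)
open import Relation.Nullary.Decidable using (_×-dec_; _⊎-dec_)
open import Relation.Binary.PropositionalEquality using (_≡_)

-- Partitions of n into parts ≤ k, each partition listed as the
-- (non-increasing) list of its parts.
partsLE : ℕ → ℕ → List (List ℕ)
partsLE zero zero = [ [] ]
partsLE zero (suc _) = []
partsLE (suc k) n =
  concatMap (λ μ → map (replicate μ (suc k) ++_) (partsLE k (n ∸ μ * suc k)))
            (filter (λ μ → μ * suc k ≤? n) (upTo (suc n)))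

partitions : ℕ → List (List ℕ)
partitions n = partsLE n n

mult : ℕ → List ℕ → ℕ
mult j λs = length (filter (λ x → x ℕ.≟ j) λs)

Good : (p r a m : ℕ) → .{{ℕ.NonZero p}} → ℕ → Set
Good p r a m μ =
  (μ % p ≡ 0 × μ ≤ p * (m ∸ 1))
  ⊎ (μ % p ≡ a % p × (p * r + a ≤ μ × μ ≤ p * r + a + p * (m ∸ 1)))

good? : (p r a m : ℕ) → .{{_ : ℕ.NonZero p}} → (μ : ℕ) → Dec (Good p r a m μ)
good? p r a m μ =
  ((μ % p ℕ.≟ 0) ×-dec (μ ≤? p * (m ∸ 1)))
  ⊎-dec ((μ % p ℕ.≟ a % p) ×-dec ((p * r + a ≤? μ) ×-dec (μ ≤? p * r + a + p * (m ∸ 1))))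

-- A partition is admissible if every part occurring in it has admissible
-- multiplicity (parts not occurring have multiplicity 0, which is always
-- admissible via the first alternative).
Admissible : (p r a m : ℕ) → .{{ℕ.NonZero p}} → List ℕ → Set
Admissible p r a m λs = All (λ j → Good p r a m (mult j λs)) λs

admissible? : (p r a m : ℕ) → .{{_ : ℕ.NonZero p}} → (λs : List ℕ) → Dec (Admissible p r a m λs)
admissible? p r a m λs = all? (λ j → good? p r a m (mult j λs)) λs

b2 : (r a m p : ℕ) → .{{ℕ.NonZero p}} → ℕ → ℕ
b2 r a m p n = length (filter (admissible? p r a m) (partitions n))

b2ℤ : (r a m p : ℕ) → .{{ℕ.NonZero p}} → ℤ → ℕ
b2ℤ r a m p (+ n) = b2 r a m p n
b2ℤ r a m p -[1+ _ ] = 0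

-- A multiplicity is admissible exactly when it is p·s + e·(pr + a) with a
-- digit 0 ≤ s < m and e ∈ {0, 1}.  So an admissible partition of N amounts to
-- a strict partition D (the parts with e = 1) together with the digits s_k of
-- all multiplicities, subject to (pr + a)·σ + p·Σ k·s_k = N where σ is the sum
-- of D.  Franklin's involution acts on D preserving σ, and is fixed-point free
-- unless σ is a generalized pentagonal number j(3j − 1)/2, in which case
-- 24σ + 1 = (6j − 1)².  Since N = pn + t forces t ≡ aσ (mod p), this would make
-- 24ta⁻¹ + 1 a square mod p.  So for a nonresidue the involution pairs off all
-- admissible partitions of pn + t.

module Submission where

open import Data.Nat using (ℕ; NonZero; _%_; _≤_)
open import Relation.Binary.PropositionalEquality using (_≢_)

module FranklinInvolution where

  open import Data.Nat
  open import Data.Nat.Properties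
  open import Data.Nat.ListAction using (sum)
  open import Data.Nat.ListAction.Properties using (sum-++)
  open import Data.Nat.Tactic.RingSolver using (solve-∀)
  open import Data.Bool using (true; false; if_then_else_)
  open import Data.List using (List; []; _∷_; [_]; _++_; length)
  open import Data.List.Properties using (length-++; ++-assoc; ++-identityʳ)
  open import Data.Product using (∃-syntax; _×_; _,_)
  open import Data.Sum using (_⊎_; inj₁; inj₂)
  open import Data.Unit using (⊤; tt)
  open import Data.Empty using (⊥-elim)
  open import Function using (_∘_)
  open import Relation.Nullary using (¬_; Dec; does; yes; no)
  open import Relation.Nullary.Decidable using (dec-true; dec-false; _×-dec_)
  open import Relation.Binary.PropositionalEquality hiding ([_])
  open ≡-Reasoning

  data Strict : List ℕ → Set where
    nil    : Strict []
    single : ∀ {x} → 1 ≤ x → Strict [ x ]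
    cons   : ∀ {x y r} → y < x → Strict (y ∷ r) → Strict (x ∷ y ∷ r)

  run : ℕ → ℕ → List ℕ
  run b zero    = []
  run b (suc n) = n + b ∷ run b n

  slope : List ℕ → ℕ
  slope []          = 0
  slope (x ∷ [])    = 1
  slope (x ∷ y ∷ r) = if does (x ≟ suc y) then suc (slope (y ∷ r)) else 1

  smallest : List ℕ → ℕ
  smallest []          = 0
  smallest (x ∷ [])    = x
  smallest (x ∷ y ∷ r) = smallest (y ∷ r)

  dropLast : List ℕ → List ℕ
  dropLast []          = []
  dropLast (x ∷ [])    = []
  dropLast (x ∷ y ∷ r) = x ∷ dropLast (y ∷ r)

  incFirst : ℕ → List ℕ → List ℕ
  incFirst zero    xs       = xs
  incFirst (suc k) []       = []
  incFirst (suc k) (x ∷ xs) = suc x ∷ incFirst k xs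

  decFirst : ℕ → List ℕ → List ℕ
  decFirst zero    xs       = xs
  decFirst (suc k) []       = []
  decFirst (suc k) (x ∷ xs) = pred x ∷ decFirst k xs

  Exceptional₁ Exceptional₂ : List ℕ → Set
  Exceptional₁ D = slope D ≡ length D × smallest D ≡ slope D
  Exceptional₂ D = slope D ≡ length D × smallest D ≡ suc (slope D)

  exceptional₁? : ∀ D → Dec (Exceptional₁ D)
  exceptional₁? D = slope D ≟ length D ×-dec smallest D ≟ slope D

  exceptional₂? : ∀ D → Dec (Exceptional₂ D)
  exceptional₂? D = slope D ≟ length D ×-dec smallest D ≟ suc (slope D)

  -- The two exceptional shapes, where this would not give a strict
  -- partition, are fixed.
  franklin : List ℕ → List ℕ
  franklin D =
    if does (smallest D ≤? slope D)
    then (if does (exceptional₁? D) then D else incFirst (smallest D) (dropLast D))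
    else (if does (exceptional₂? D) then D else decFirst (slope D) D ++ [ slope D ])

  Pentagonal : ℕ → Set
  Pentagonal σ = ∃[ l ] (2 * σ + l ≡ 3 * (l * l) ⊎ 2 * σ ≡ 3 * (l * l) + l)

  record FranklinAt (D : List ℕ) : Set where
    field
      strict           : Strict (franklin D)
      sum-franklin     : sum (franklin D) ≡ sum D
      involutive       : franklin (franklin D) ≡ D
      fixed⇒pentagonal : franklin D ≡ D → Pentagonal (sum D)

  franklin-smallest≤slope : ∀ D → smallest D ≤ slope D → ¬ Exceptional₁ D →
    franklin D ≡ incFirst (smallest D) (dropLast D)
  franklin-smallest≤slope D s≤l ¬exc
    rewrite dec-true (smallest D ≤? slope D) s≤l | dec-false (exceptional₁? D) ¬exc = refl

  franklin-slope<smallest : ∀ D → slope D < smallest D → ¬ Exceptional₂ D →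
    franklin D ≡ decFirst (slope D) D ++ [ slope D ]
  franklin-slope<smallest D l<s ¬exc
    rewrite dec-false (smallest D ≤? slope D) (<⇒≱ l<s) | dec-false (exceptional₂? D) ¬exc = refl

  franklin-exceptional₁ : ∀ D → Exceptional₁ D → franklin D ≡ D
  franklin-exceptional₁ D exc@(_ , s≡l)
    rewrite dec-true (smallest D ≤? slope D) (≤-reflexive s≡l) | dec-true (exceptional₁? D) exc = refl

  franklin-exceptional₂ : ∀ D → Exceptional₂ D → franklin D ≡ D
  franklin-exceptional₂ D exc@(_ , s≡1+l)
    rewrite dec-false (smallest D ≤? slope D) (<⇒≱ (≤-reflexive (sym s≡1+l)))
          | dec-true (exceptional₂? D) exc = refl

  Breaks : ℕ → List ℕ → Set
  Breaks b []      = ⊤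
  Breaks b (y ∷ _) = b ≢ suc y

  data RunView : List ℕ → Set where
    run++ : ∀ b n R → Breaks b R → RunView (run b (suc n) ++ R)

  runView : ∀ x xs → RunView (x ∷ xs)
  runView x [] = run++ x 0 [] tt
  runView x (y ∷ r) with x ≟ suc y
  ... | no x≢1+y = run++ x 0 (y ∷ r) x≢1+y
  ... | yes refl with runView y r
  ...   | run++ b n R br = run++ b (suc n) R br

  run-+ : ∀ b m k → run b (m + k) ≡ run (k + b) m ++ run b k
  run-+ b zero    k = refl
  run-+ b (suc m) k = cong₂ _∷_ (+-assoc m k b) (run-+ b m k)

  run-∷ʳ : ∀ b n → run (suc b) n ++ [ b ] ≡ run b (suc n)
  run-∷ʳ b zero    = refl
  run-∷ʳ b (suc n) = cong₂ _∷_ (+-suc n b) (run-∷ʳ b n)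

  incFirst-run : ∀ c m X → incFirst m (run c m ++ X) ≡ run (suc c) m ++ X
  incFirst-run c zero    X = refl
  incFirst-run c (suc m) X = cong₂ _∷_ (sym (+-suc m c)) (incFirst-run c m X)

  decFirst-run : ∀ c m X → decFirst m (run (suc c) m ++ X) ≡ run c m ++ X
  decFirst-run c zero    X = refl
  decFirst-run c (suc m) X = cong₂ _∷_ (cong pred (+-suc m c)) (decFirst-run c m X)

  length-run++ : ∀ b n R → length (run b n ++ R) ≡ n + length R
  length-run++ b zero    R = refl
  length-run++ b (suc n) R = cong suc (length-run++ b n R)

  sum-run-suc : ∀ c m → sum (run (suc c) m) ≡ m + sum (run c m)
  sum-run-suc c zero    = refl
  sum-run-suc c (suc m) rewrite sum-run-suc c m | +-suc m c =
    shuffle m c (sum (run c m))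
    where
    shuffle : ∀ m c s → suc (m + c) + (m + s) ≡ suc m + ((m + c) + s)
    shuffle = solve-∀

  sum-run : ∀ b l → 2 * sum (run b l) + l ≡ l * l + 2 * (l * b)
  sum-run b zero    = refl
  sum-run b (suc l) = begin
    2 * (l + b + s) + suc l                  ≡⟨ regroup l b s ⟩
    (2 * s + l) + (2 * (l + b) + 1)          ≡⟨ cong (_+ (2 * (l + b) + 1)) (sum-run b l) ⟩
    l * l + 2 * (l * b) + (2 * (l + b) + 1)  ≡⟨ square-suc l b ⟩
    suc l * suc l + 2 * (suc l * b)          ∎
    where
    s = sum (run b l)
    regroup : ∀ l b s → 2 * (l + b + s) + suc l ≡ (2 * s + l) + (2 * (l + b) + 1)
    regroup = solve-∀
    square-suc : ∀ l b → l * l + 2 * (l * b) + (2 * (l + b) + 1) ≡ suc l * suc l + 2 * (suc l * b)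
    square-suc = solve-∀

  pentagonal-run : ∀ l → Pentagonal (sum (run l l ++ []))
  pentagonal-run l rewrite ++-identityʳ (run l l) = l , inj₁ (trans (sum-run l l) (triple l))
    where
    triple : ∀ l → l * l + 2 * (l * l) ≡ 3 * (l * l)
    triple = solve-∀

  pentagonal-run-suc : ∀ l → Pentagonal (sum (run (suc l) l ++ []))
  pentagonal-run-suc l rewrite ++-identityʳ (run (suc l) l) =
    l , inj₂ (+-cancelʳ-≡ l _ _ (trans (sum-run (suc l) l) (expand l)))
    where
    expand : ∀ l → l * l + 2 * (l * suc l) ≡ 3 * (l * l) + l + l
    expand = solve-∀

  slope-pos : ∀ x xs → 1 ≤ slope (x ∷ xs)
  slope-pos x []      = s≤s z≤n
  slope-pos x (y ∷ r) with does (x ≟ suc y)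
  ... | true  = s≤s z≤n
  ... | false = s≤s z≤n

  slope-run : ∀ b n R → Breaks b R → slope (run b (suc n) ++ R) ≡ suc n
  slope-run b zero    []      _  = refl
  slope-run b zero    (y ∷ R) br rewrite dec-false (b ≟ suc y) br = refl
  slope-run b (suc n) R       br rewrite dec-true (suc (n + b) ≟ suc (n + b)) refl =
    cong suc (slope-run b n R br)

  slope-run-≥ : ∀ b n R → suc n ≤ slope (run b (suc n) ++ R)
  slope-run-≥ b zero    R = slope-pos b R
  slope-run-≥ b (suc n) R rewrite dec-true (suc (n + b) ≟ suc (n + b)) refl = s≤s (slope-run-≥ b n R)

  smallest-∷ʳ : ∀ X y → smallest (X ++ [ y ]) ≡ y
  smallest-∷ʳ []           y = refl
  smallest-∷ʳ (x ∷ [])     y = refl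
  smallest-∷ʳ (x ∷ x′ ∷ X) y = smallest-∷ʳ (x′ ∷ X) y

  smallest-++ : ∀ X y Y → smallest (X ++ y ∷ Y) ≡ smallest (y ∷ Y)
  smallest-++ []           y Y = refl
  smallest-++ (x ∷ [])     y Y = refl
  smallest-++ (x ∷ x′ ∷ X) y Y = smallest-++ (x′ ∷ X) y Y

  smallest-run++[] : ∀ b n → smallest (run b (suc n) ++ []) ≡ b
  smallest-run++[] b zero    = refl
  smallest-run++[] b (suc n) = smallest-run++[] b n

  smallest-raise : ∀ C n R → smallest (run C (suc n) ++ R) ≤ smallest (run (suc C) (suc n) ++ R)
  smallest-raise C n [] rewrite smallest-run++[] C n | smallest-run++[] (suc C) n = n≤1+n C
  smallest-raise C n (y ∷ R)
    rewrite smallest-++ (run C (suc n)) y R | smallest-++ (run (suc C) (suc n)) y R = ≤-refl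

  dropLast-∷ʳ : ∀ X y → dropLast (X ++ [ y ]) ≡ X
  dropLast-∷ʳ []           y = refl
  dropLast-∷ʳ (x ∷ [])     y = refl
  dropLast-∷ʳ (x ∷ x′ ∷ X) y = cong (x ∷_) (dropLast-∷ʳ (x′ ∷ X) y)

  dropLast-∷ʳ-smallest : ∀ y R → dropLast (y ∷ R) ++ [ smallest (y ∷ R) ] ≡ y ∷ R
  dropLast-∷ʳ-smallest y []      = refl
  dropLast-∷ʳ-smallest y (z ∷ R) = cong (y ∷_) (dropLast-∷ʳ-smallest z R)

  strict-head-pos : ∀ {x xs} → Strict (x ∷ xs) → 1 ≤ x
  strict-head-pos (single 1≤x) = 1≤x
  strict-head-pos (cons y<x _) = ≤-trans (s≤s z≤n) y<x

  strict-tail : ∀ {x xs} → Strict (x ∷ xs) → Strict xs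
  strict-tail (single _) = nil
  strict-tail (cons _ s) = s

  strict-smallest-pos : ∀ {x xs} → Strict (x ∷ xs) → 1 ≤ smallest (x ∷ xs)
  strict-smallest-pos (single 1≤x) = 1≤x
  strict-smallest-pos (cons _ s)   = strict-smallest-pos s

  strict-raiseHead : ∀ {b c R} → Strict (b ∷ R) → b ≤ c → Strict (c ∷ R)
  strict-raiseHead (single 1≤b) b≤c = single (≤-trans 1≤b b≤c)
  strict-raiseHead (cons y<b s) b≤c = cons (<-≤-trans y<b b≤c) s

  strict-run : ∀ b n R → Strict (b ∷ R) → Strict (run b (suc n) ++ R)
  strict-run b zero    R s = s
  strict-run b (suc n) R s = cons ≤-refl (strict-run b n R s)

  strict-run⁻ : ∀ b n R → Strict (run b (suc n) ++ R) → Strict (b ∷ R)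
  strict-run⁻ b zero    R s          = s
  strict-run⁻ b (suc n) R (cons _ s) = strict-run⁻ b n R s

  strict-++ʳ : ∀ X {Y} → Strict (X ++ Y) → Strict Y
  strict-++ʳ []      s = s
  strict-++ʳ (x ∷ X) s = strict-++ʳ X (strict-tail s)

  strict-++ˡ : ∀ X Y → Strict (X ++ Y) → Strict X
  strict-++ˡ []           Y s          = nil
  strict-++ˡ (x ∷ [])     Y s          = single (strict-head-pos s)
  strict-++ˡ (x ∷ x′ ∷ X) Y (cons p s) = cons p (strict-++ˡ (x′ ∷ X) Y s)

  strict-∷ʳ⁻ : ∀ x X s → Strict (x ∷ X ++ [ s ]) → s < smallest (x ∷ X)
  strict-∷ʳ⁻ x []       s (cons s<x _) = s<x
  strict-∷ʳ⁻ x (x′ ∷ X) s (cons _ st)  = strict-∷ʳ⁻ x′ X s st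

  strict-∷ʳ : ∀ y Y x → Strict (y ∷ Y) → x < smallest (y ∷ Y) → 1 ≤ x → Strict (y ∷ Y ++ [ x ])
  strict-∷ʳ y []      x _          x<y 1≤x = cons x<y (single 1≤x)
  strict-∷ʳ y (z ∷ Z) x (cons p s) x<s 1≤x = cons p (strict-∷ʳ z Z x s x<s 1≤x)

  slope≢length : ∀ b n y R → Breaks b (y ∷ R) →
    slope (run b (suc n) ++ y ∷ R) ≢ length (run b (suc n) ++ y ∷ R)
  slope≢length b n y R br l≡len = m≢1+m+n (suc n) (begin
    suc n                                ≡⟨ slope-run b n (y ∷ R) br ⟨
    slope (run b (suc n) ++ y ∷ R)       ≡⟨ l≡len ⟩
    length (run b (suc n) ++ y ∷ R)      ≡⟨ length-run++ b (suc n) (y ∷ R) ⟩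
    suc n + suc (length R)               ≡⟨ +-suc (suc n) (length R) ⟩
    suc (suc n + length R)               ∎)

  -- low C s R has the smallest part s below a top run ending in C; franklin
  -- spreads that part over the top s parts, which gives high C s R, and back.
  low : ℕ → ℕ → List ℕ → List ℕ
  low C s R = run C s ++ (R ++ [ s ])

  high : ℕ → ℕ → List ℕ → List ℕ
  high C s R = run (suc C) s ++ R

  low-assoc : ∀ C s R → low C s R ≡ (run C s ++ R) ++ [ s ]
  low-assoc C s R = sym (++-assoc (run C s) R [ s ])

  sum-high : ∀ C s R → sum (high C s R) ≡ sum (low C s R)
  sum-high C s R = begin
    sum (run (suc C) s ++ R)            ≡⟨ sum-++ (run (suc C) s) R ⟩
    sum (run (suc C) s) + sum R         ≡⟨ cong (_+ sum R) (sum-run-suc C s) ⟩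
    s + sum (run C s) + sum R           ≡⟨ move s (sum (run C s)) (sum R) ⟩
    sum (run C s) + (sum R + (s + 0))   ≡⟨ cong (sum (run C s) +_) (sum-++ R [ s ]) ⟨
    sum (run C s) + sum (R ++ [ s ])    ≡⟨ sum-++ (run C s) (R ++ [ s ]) ⟨
    sum (low C s R)                     ∎
    where
    move : ∀ s x y → s + x + y ≡ x + (y + (s + 0))
    move = solve-∀

  length-low : ∀ C s R → length (low C s R) ≡ suc (s + length R)
  length-low C s R = begin
    length (run C s ++ (R ++ [ s ]))   ≡⟨ length-run++ C s (R ++ [ s ]) ⟩
    s + length (R ++ [ s ])            ≡⟨ cong (s +_) (length-++ R) ⟩
    s + (length R + 1)                 ≡⟨ cong (s +_) (+-comm (length R) 1) ⟩
    s + suc (length R)                 ≡⟨ +-suc s (length R) ⟩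
    suc (s + length R)                 ∎

  length-high≢low : ∀ C s R → length (high C s R) ≢ length (low C s R)
  length-high≢low C s R e = 1+n≢n (sym (trans (sym (length-run++ (suc C) s R)) (trans e (length-low C s R))))

  franklin-low : ∀ C s₀ R → franklin (low C (suc s₀) R) ≡ high C (suc s₀) R
  franklin-low C s₀ R = begin
    franklin D                          ≡⟨ franklin-smallest≤slope D s≤slope notExceptional ⟩
    incFirst (smallest D) (dropLast D)  ≡⟨ cong₂ incFirst smallest≡s dropLast≡ ⟩
    incFirst s (run C s ++ R)           ≡⟨ incFirst-run C s R ⟩
    high C s R                          ∎
    where
    s = suc s₀
    D = low C s R
    smallest≡s : smallest D ≡ s
    smallest≡s = trans (cong smallest (low-assoc C s R)) (smallest-∷ʳ (run C s ++ R) s)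
    dropLast≡ : dropLast D ≡ run C s ++ R
    dropLast≡ = trans (cong dropLast (low-assoc C s R)) (dropLast-∷ʳ (run C s ++ R) s)
    s≤slope : smallest D ≤ slope D
    s≤slope = subst (_≤ slope D) (sym smallest≡s) (slope-run-≥ C s₀ (R ++ [ s ]))
    notExceptional : ¬ Exceptional₁ D
    notExceptional (l≡len , s≡l) =
      m≢1+m+n s (trans (sym smallest≡s) (trans s≡l (trans l≡len (length-low C s R))))

  franklin-high : ∀ C s₀ R → Breaks (suc C) R → suc s₀ < smallest (high C (suc s₀) R) →
    ¬ Exceptional₂ (high C (suc s₀) R) → franklin (high C (suc s₀) R) ≡ low C (suc s₀) R
  franklin-high C s₀ R br s<smallest ¬exc = begin
    franklin D                            ≡⟨ franklin-slope<smallest D l<smallest ¬exc ⟩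
    decFirst (slope D) D ++ [ slope D ]   ≡⟨ cong (λ l → decFirst l D ++ [ l ]) slope≡s ⟩
    decFirst s D ++ [ s ]                 ≡⟨ cong (_++ [ s ]) (decFirst-run C s R) ⟩
    (run C s ++ R) ++ [ s ]               ≡⟨ low-assoc C s R ⟨
    low C s R                             ∎
    where
    s = suc s₀
    D = high C s R
    slope≡s = slope-run (suc C) s₀ R br
    l<smallest = subst (_< smallest D) (sym slope≡s) s<smallest

  strict-high : ∀ C s₀ R → Strict (low C (suc s₀) R) → Strict (high C (suc s₀) R)
  strict-high C s₀ R st = strict-run (suc C) s₀ R (strict-raiseHead strict-C∷R (n≤1+n C))
    where
    s = suc s₀
    strict-C∷R : Strict (C ∷ R)
    strict-C∷R = strict-run⁻ C s₀ R (strict-++ˡ (run C s ++ R) [ s ] (subst Strict (low-assoc C s R) st))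

  strict-low : ∀ C n R → Breaks (suc C) R → Strict (high C (suc n) R) →
    suc n < smallest (high C (suc n) R) → ¬ Exceptional₂ (high C (suc n) R) → Strict (low C (suc n) R)
  strict-low C n []      _  _  n<s ¬exc = strict-run C n [ suc n ] (cons n<C (single (s≤s z≤n)))
    where
    n<C : suc n < C
    n<C = ≤∧≢⇒< (s≤s⁻¹ (subst (suc n <_) (smallest-run++[] (suc C) n) n<s))
      (λ { refl → ¬exc ( trans (slope-run (suc C) n [] tt) (sym (trans (length-run++ (suc C) (suc n) []) (+-identityʳ (suc n))))
                        , trans (smallest-run++[] (suc C) n) (cong suc (sym (slope-run (suc C) n [] tt))) ) })
  strict-low C n (y ∷ R) br st n<s _ with strict-run⁻ (suc C) n (y ∷ R) st
  ... | cons y<1+C st-y∷R = strict-run C n (y ∷ R ++ [ suc n ])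
          (cons (≤∧≢⇒< (s≤s⁻¹ y<1+C) (λ y≡C → br (cong suc (sym y≡C))))
                (strict-∷ʳ y R (suc n) st-y∷R n<smallest (s≤s z≤n)))
    where
    n<smallest = subst (suc n <_) (smallest-++ (run (suc C) (suc n)) y R) n<s

  franklinAt-swap : ∀ {D D′} → franklin D ≡ D′ → franklin D′ ≡ D → Strict D′ → sum D′ ≡ sum D →
    length D′ ≢ length D → FranklinAt D
  franklinAt-swap refl back st sum≡ length≢ = record
    { strict           = st
    ; sum-franklin     = sum≡
    ; involutive       = back
    ; fixed⇒pentagonal = λ fixed → ⊥-elim (length≢ (cong length fixed))
    }

  franklinAt-fixed : ∀ {D} → franklin D ≡ D → Strict D → Pentagonal (sum D) → FranklinAt D
  franklinAt-fixed fixed st pent = record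
    { strict           = subst Strict (sym fixed) st
    ; sum-franklin     = cong sum fixed
    ; involutive       = trans (cong franklin fixed) fixed
    ; fixed⇒pentagonal = λ _ → pent
    }

  franklinAt-low : ∀ C s R → 1 ≤ s → Breaks (suc C) R → Strict (low C s R) → FranklinAt (low C s R)
  franklinAt-low C (suc s₀) R _ br st =
    franklinAt-swap (franklin-low C s₀ R) (franklin-high C s₀ R br s<smallest (notExceptional R br top-s<))
                    (strict-high C s₀ R st) (sum-high C s R) (length-high≢low C s R)
    where
    s = suc s₀
    top-s< : s < smallest (run C s ++ R)
    top-s< = strict-∷ʳ⁻ (s₀ + C) (run C s₀ ++ R) s (subst Strict (low-assoc C s R) st)
    s<smallest : s < smallest (high C s R)
    s<smallest = <-≤-trans top-s< (smallest-raise C s₀ R)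
    notExceptional : ∀ R → Breaks (suc C) R → s < smallest (run C s ++ R) → ¬ Exceptional₂ (high C s R)
    notExceptional []      _  s<C (_ , s≡1+l) = <-irrefl (sym C≡s) (subst (s <_) (smallest-run++[] C s₀) s<C)
      where
      C≡s : C ≡ s
      C≡s = suc-injective (trans (sym (smallest-run++[] (suc C) s₀))
                                 (trans s≡1+l (cong suc (slope-run (suc C) s₀ [] tt))))
    notExceptional (y ∷ R) br _ (l≡len , _) = slope≢length (suc C) s₀ y R br l≡len

  franklinAt-high : ∀ C n R → Breaks (suc C) R → Strict (high C (suc n) R) →
    suc n < smallest (high C (suc n) R) → ¬ Exceptional₂ (high C (suc n) R) → FranklinAt (high C (suc n) R)
  franklinAt-high C n R br st n<s ¬exc =
    franklinAt-swap (franklin-high C n R br n<s ¬exc) (franklin-low C n R) (strict-low C n R br st n<s ¬exc)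
                    (sym (sum-high C (suc n) R)) (λ e → length-high≢low C (suc n) R (sym e))

  breaks-run : ∀ j B X → Breaks (suc B) X → Breaks (suc (j + B)) (run B j ++ X)
  breaks-run zero    B X br = br
  breaks-run (suc j) B X _  = 1+n≢n ∘ suc-injective

  breaks-dropLast : ∀ b y R → y < b → Breaks (suc b) (dropLast (y ∷ R))
  breaks-dropLast b y []      _   = tt
  breaks-dropLast b y (z ∷ R) y<b = <⇒≢ y<b ∘ sym ∘ suc-injective

  low-decomposition-run : ∀ b n → b ≤ n → run b (suc n) ++ [] ≡ low (n ∸ b + suc b) b (run (suc b) (n ∸ b))
  low-decomposition-run b n b≤n = begin
    run b (suc n) ++ []                            ≡⟨ ++-identityʳ (run b (suc n)) ⟩
    run b (suc n)                                  ≡⟨ run-∷ʳ b n ⟨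
    run (suc b) n ++ [ b ]                         ≡⟨ cong (λ k → run (suc b) k ++ [ b ]) (m+[n∸m]≡n b≤n) ⟨
    run (suc b) (b + j) ++ [ b ]                   ≡⟨ cong (_++ [ b ]) (run-+ (suc b) b j) ⟩
    (run (j + suc b) b ++ run (suc b) j) ++ [ b ]  ≡⟨ ++-assoc (run (j + suc b) b) (run (suc b) j) [ b ] ⟩
    low (j + suc b) b (run (suc b) j)              ∎
    where j = n ∸ b

  low-decomposition-tail : ∀ b n y R → let s = smallest (y ∷ R) ; j = suc n ∸ s in s ≤ suc n →
    run b (suc n) ++ y ∷ R ≡ low (j + b) s (run b j ++ dropLast (y ∷ R))
  low-decomposition-tail b n y R s≤l = begin
    run b (suc n) ++ y ∷ R                                  ≡⟨ cong (λ k → run b k ++ y ∷ R) (m+[n∸m]≡n s≤l) ⟨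
    run b (s + j) ++ y ∷ R                                  ≡⟨ cong (run b (s + j) ++_) (dropLast-∷ʳ-smallest y R) ⟨
    run b (s + j) ++ (T ++ [ s ])                           ≡⟨ cong (_++ (T ++ [ s ])) (run-+ b s j) ⟩
    (run (j + b) s ++ run b j) ++ (T ++ [ s ])              ≡⟨ ++-assoc (run (j + b) s) (run b j) (T ++ [ s ]) ⟩
    run (j + b) s ++ (run b j ++ (T ++ [ s ]))              ≡⟨ cong (run (j + b) s ++_) (++-assoc (run b j) T [ s ]) ⟨
    low (j + b) s (run b j ++ T)                            ∎
    where
    s = smallest (y ∷ R)
    j = suc n ∸ s
    T = dropLast (y ∷ R)

  franklinAt-smallest≤slope : ∀ b n R → Breaks (suc b) R → Strict (run (suc b) (suc n) ++ R) →
    smallest (run (suc b) (suc n) ++ R) ≤ suc n → FranklinAt (run (suc b) (suc n) ++ R)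
  franklinAt-smallest≤slope b n [] _ st s≤l with suc b ≟ suc n
  ... | yes refl = franklinAt-fixed (franklin-exceptional₁ D (l≡len , s≡l)) st (pentagonal-run (suc n))
    where
    D = run (suc n) (suc n) ++ []
    l≡len : slope D ≡ length D
    l≡len = trans (slope-run (suc n) n [] tt) (sym (trans (length-run++ (suc n) (suc n) []) (+-identityʳ (suc n))))
    s≡l : smallest D ≡ slope D
    s≡l = trans (smallest-run++[] (suc n) n) (sym (slope-run (suc n) n [] tt))
  ... | no b≢n = subst FranklinAt (sym decomposition)
                   (franklinAt-low C (suc b) Rr (s≤s z≤n) breaks (subst Strict decomposition st))
    where
    b<l = ≤∧≢⇒< (subst (_≤ suc n) (smallest-run++[] (suc b) n) s≤l) b≢n
    C  = n ∸ suc b + suc (suc b)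
    Rr = run (suc (suc b)) (n ∸ suc b)
    decomposition = low-decomposition-run (suc b) n (s≤s⁻¹ b<l)
    breaks : Breaks (suc C) Rr
    breaks = subst (Breaks (suc C)) (++-identityʳ Rr) (breaks-run (n ∸ suc b) (suc (suc b)) [] tt)
  franklinAt-smallest≤slope b n (y ∷ R) br st s≤l =
    subst FranklinAt (sym decomposition) (franklinAt-low (j + suc b) s Rr 1≤s breaks (subst Strict decomposition st))
    where
    s  = smallest (y ∷ R)
    j  = suc n ∸ s
    Rr = run (suc b) j ++ dropLast (y ∷ R)
    decomposition = low-decomposition-tail (suc b) n y R (subst (_≤ suc n) (smallest-++ (run (suc b) (suc n)) y R) s≤l)
    1≤s : 1 ≤ s
    1≤s = strict-smallest-pos (strict-++ʳ (run (suc b) (suc n)) st)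
    y<b : y < suc b
    y<b with strict-run⁻ (suc b) n (y ∷ R) st
    ... | cons y<b _ = y<b
    breaks : Breaks (suc (j + suc b)) Rr
    breaks = breaks-run j (suc b) (dropLast (y ∷ R)) (breaks-dropLast (suc b) y R y<b)

  franklinAt-exceptional₂ : ∀ b n R → Breaks b R → Strict (run b (suc n) ++ R) →
    Exceptional₂ (run b (suc n) ++ R) → FranklinAt (run b (suc n) ++ R)
  franklinAt-exceptional₂ b n [] _ st exc@(_ , s≡1+l) with b≡2+n
    where
    b≡2+n : b ≡ suc (suc n)
    b≡2+n = trans (sym (smallest-run++[] b n)) (trans s≡1+l (cong suc (slope-run b n [] tt)))
  ... | refl = franklinAt-fixed (franklin-exceptional₂ _ exc) st (pentagonal-run-suc (suc n))
  franklinAt-exceptional₂ b n (y ∷ R) br _ (l≡len , _) = ⊥-elim (slope≢length b n y R br l≡len)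

  franklinAt-run : ∀ b n R → Breaks b R → Strict (run b (suc n) ++ R) → FranklinAt (run b (suc n) ++ R)
  franklinAt-run zero n R _ st with strict-head-pos (strict-run⁻ zero n R st)
  ... | ()
  franklinAt-run (suc b) n R br st with smallest (run (suc b) (suc n) ++ R) ≤? suc n
  ... | yes s≤l = franklinAt-smallest≤slope b n R br st s≤l
  ... | no s≰l with exceptional₂? (run (suc b) (suc n) ++ R)
  ...   | yes exc  = franklinAt-exceptional₂ (suc b) n R br st exc
  ...   | no  ¬exc = franklinAt-high b n R br st (≰⇒> s≰l) ¬exc

  franklinAt : ∀ D → Strict D → FranklinAt D
  franklinAt []       _  = franklinAt-fixed refl nil (0 , inj₁ refl)
  franklinAt (x ∷ xs) st with runView x xs
  ... | run++ b n R br = franklinAt-run b n R br st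

module Involutions where

  open import Data.Nat using (suc; _≤_; s≤s)
  open import Data.Nat.Properties using (≤-trans; n≤1+n; ≤-refl)
  open import Data.Nat.Divisibility using (_∣_; divides; ∣-refl; ∣m∣n⇒∣m+n)
  open import Data.List using (List; []; _∷_; length; filter)
  open import Data.List.Properties using (filter-all)
  open import Data.List.Membership.Propositional using (_∈_; _∉_)
  open import Data.List.Membership.Propositional.Properties using (∈-filter⁺; ∈-filter⁻)
  open import Data.List.Relation.Unary.Unique.Propositional using (Unique)
  open import Data.List.Relation.Unary.AllPairs as AllPairs using ([]; _∷_)
  open import Data.List.Relation.Unary.Unique.Propositional.Properties using (filter⁺)
  import Data.List.Relation.Unary.All as All
  open import Data.List.Relation.Unary.Any using (here; there)
  open import Data.Product using (_,_; proj₁)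
  open import Data.Empty using (⊥-elim)
  open import Function using (_∘_)
  open import Relation.Nullary using (¬?; yes; no)
  open import Relation.Binary.Definitions using (DecidableEquality)
  open import Relation.Binary.PropositionalEquality

  record FixedPointFreeInvolutionOn {A : Set} (ι : A → A) (xs : List A) : Set where
    field
      closed         : ∀ {x} → x ∈ xs → ι x ∈ xs
      involutive     : ∀ {x} → x ∈ xs → ι (ι x) ≡ x
      no-fixed-point : ∀ {x} → x ∈ xs → ι x ≢ x

  module _ {A : Set} (_≟_ : DecidableEquality A) where

    remove : A → List A → List A
    remove y = filter (λ z → ¬? (z ≟ y))

    length-remove : ∀ {y} xs → Unique xs → y ∈ xs → length xs ≡ suc (length (remove y xs))
    length-remove (x ∷ xs) (x∉xs ∷ _) (here refl) with x ≟ x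
    ... | no x≢x = ⊥-elim (x≢x refl)
    ... | yes _  = cong (suc ∘ length) (sym (filter-all (λ z → ¬? (z ≟ x)) (All.map (λ x≢z → x≢z ∘ sym) x∉xs)))
    length-remove {y} (x ∷ xs) (x∉xs ∷ u) (there y∈xs) with x ≟ y
    ... | yes refl = ⊥-elim (All.lookup x∉xs y∈xs refl)
    ... | no _     = cong suc (length-remove xs u y∈xs)

    module _ {ι : A → A} {x : A} {xs : List A} (u : Unique (x ∷ xs))
             (f : FixedPointFreeInvolutionOn ι (x ∷ xs)) where
      open FixedPointFreeInvolutionOn f

      ιx∈xs : ι x ∈ xs
      ιx∈xs with closed (here refl)
      ... | here ιx≡x = ⊥-elim (no-fixed-point (here refl) ιx≡x)
      ... | there ιx∈ = ιx∈

      fixedPointFree-remove : FixedPointFreeInvolutionOn ι (remove (ι x) xs)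
      fixedPointFree-remove = record
        { closed         = closed′
        ; involutive     = λ w∈ → involutive (there (member w∈))
        ; no-fixed-point = λ w∈ → no-fixed-point (there (member w∈))
        }
        where
        x∉xs : x ∉ xs
        x∉xs x∈xs = All.lookup (AllPairs.head u) x∈xs refl
        member : ∀ {w} → w ∈ remove (ι x) xs → w ∈ xs
        member = proj₁ ∘ ∈-filter⁻ (λ z → ¬? (z ≟ ι x))
        closed′ : ∀ {w} → w ∈ remove (ι x) xs → ι w ∈ remove (ι x) xs
        closed′ {w} w∈ with ∈-filter⁻ (λ z → ¬? (z ≟ ι x)) w∈
        ... | w∈xs , w≢ιx with closed (there w∈xs)
        ...   | here ιw≡x   = ⊥-elim (w≢ιx (trans (sym (involutive (there w∈xs))) (cong ι ιw≡x)))
        ...   | there ιw∈xs = ∈-filter⁺ (λ z → ¬? (z ≟ ι x)) ιw∈xs λ ιw≡ιx →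
                x∉xs (subst (_∈ xs) (trans (sym (involutive (there w∈xs)))
                                           (trans (cong ι ιw≡ιx) (involutive (here refl)))) w∈xs)

    fixedPointFree⇒even : ∀ {ι} xs → Unique xs → FixedPointFreeInvolutionOn ι xs → 2 ∣ length xs
    fixedPointFree⇒even xs = bounded (length xs) xs ≤-refl
      where
      bounded : ∀ {ι} n xs → length xs ≤ n → Unique xs → FixedPointFreeInvolutionOn ι xs → 2 ∣ length xs
      bounded _       []       _           _ _ = divides 0 refl
      bounded {ι} (suc n) (x ∷ xs) (s≤s len≤n) u@(_ ∷ u′) f =
        subst (λ k → 2 ∣ suc k) (sym length≡) (∣m∣n⇒∣m+n (∣-refl {2}) ih)
        where
        ws = remove (ι x) xs
        length≡ : length xs ≡ suc (length ws)
        length≡ = length-remove xs u′ (ιx∈xs u f)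
        ih : 2 ∣ length ws
        ih = bounded n ws (≤-trans (n≤1+n _) (subst (_≤ n) length≡ len≤n))
                     (filter⁺ (λ z → ¬? (z ≟ ι x)) u′) (fixedPointFree-remove u f)

module Encoding (p r a m : ℕ) .{{_ : NonZero p}} (a%p≢0 : a % p ≢ 0) (1≤m : 1 ≤ m) where

  open import Data.Nat
  open import Data.Nat.Properties
  open import Data.Nat.DivMod
  open import Data.Nat.Divisibility using (_∣_)
  open import Data.Nat.ListAction using (sum)
  open import Data.Nat.Tactic.RingSolver using (solve-∀)
  open import Data.Bool using (Bool; true; false; if_then_else_)
  open import Data.List using (List; []; _∷_; [_]; _++_; length; map; concatMap; filter; upTo; replicate)
  open import Data.List.Properties as List
    using (length-++; length-map; filter-++; filter-accept; filter-reject; ∷-injectiveˡ; ∷-injectiveʳ)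
  open import Data.List.Membership.Propositional using (_∈_; find; lose)
  open import Data.List.Membership.Propositional.Properties
    using (∈-map⁻; ∈-map⁺; ∈-concatMap⁻; ∈-concatMap⁺; ∈-filter⁺; ∈-filter⁻; ∈-upTo⁺)
  open import Data.List.Relation.Unary.All as All using (All; []; _∷_)
  open import Data.List.Relation.Unary.All.Properties as All using (++⁺; ++⁻; replicate⁺; replicate⁻)
  open import Data.List.Relation.Unary.Any using (here; there)
  open import Data.List.Relation.Unary.AllPairs as AllPairs using ([]; _∷_)
  import Data.List.Relation.Unary.AllPairs.Properties as AllPairs
  open import Data.List.Relation.Unary.Unique.Propositional using (Unique)
  import Data.List.Relation.Unary.Unique.Propositional.Properties as Unique
  open import Data.Product using (∃-syntax; _×_; _,_; proj₁; proj₂)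
  import Data.Product.Properties as ×
  open import Data.Sum using (inj₁; inj₂)
  open import Data.Empty using (⊥-elim)
  open import Data.Unit using (⊤; tt)
  open import Function using (id; _∘_; _⇔_; mk⇔; Equivalence)
  open import Relation.Nullary using (¬_; does; yes; no)
  open import Relation.Nullary.Decidable using (dec-true; dec-false)
  open import Relation.Unary using (Decidable)
  open import Relation.Binary.Definitions using (DecidableEquality)
  open import Relation.Binary.PropositionalEquality hiding ([_])
  open import Defs using (Good; good?; Admissible; admissible?; partsLE; mult; b2)
  open FranklinInvolution
    using (Strict; nil; single; cons; strict-tail; strict-head-pos; franklin; franklinAt; FranklinAt; Pentagonal)
  open Involutions using (FixedPointFreeInvolutionOn; fixedPointFree⇒even)

  offset : ℕ
  offset = p * r + a

  inOffsetClass : ℕ → Bool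
  inOffsetClass μ = does (μ % p ≟ a % p)

  offsetIf : Bool → ℕ
  offsetIf true  = offset
  offsetIf false = 0

  digit : ℕ → ℕ
  digit μ = if inOffsetClass μ then μ / p ∸ offset / p else μ / p

  offset%p : offset % p ≡ a % p
  offset%p = trans (%-congˡ (+-comm (p * r) a)) (trans (%-congˡ (cong (a +_) (*-comm p r))) ([m+kn]%n≡m%n a r p))

  <m⇒≤m∸1 : ∀ {s} → s < m → s ≤ m ∸ 1
  <m⇒≤m∸1 = ∸-monoˡ-≤ 1

  m∸1<m : m ∸ 1 < m
  m∸1<m = ≤-reflexive (trans (+-comm 1 (m ∸ 1)) (m∸n+n≡m 1≤m))

  good⇒digits : ∀ {μ} → Good p r a m μ → μ ≡ p * digit μ + offsetIf (inOffsetClass μ) × digit μ < m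
  good⇒digits {μ} (inj₁ (μ%p≡0 , μ≤)) rewrite dec-false (μ % p ≟ a % p) (λ e → a%p≢0 (trans (sym e) μ%p≡0)) =
    μ≡ , ≤-<-trans digit≤m∸1 m∸1<m
    where
    μ≡′ : μ ≡ μ / p * p
    μ≡′ = trans (m≡m%n+[m/n]*n μ p) (cong (_+ μ / p * p) μ%p≡0)
    μ≡ : μ ≡ p * (μ / p) + 0
    μ≡ = trans μ≡′ (trans (*-comm (μ / p) p) (sym (+-identityʳ _)))
    digit≤m∸1 : μ / p ≤ m ∸ 1
    digit≤m∸1 = *-cancelʳ-≤ (μ / p) (m ∸ 1) p
      (subst (_≤ (m ∸ 1) * p) μ≡′ (subst (μ ≤_) (*-comm p (m ∸ 1)) μ≤))
  good⇒digits {μ} (inj₂ (μ%p≡a%p , offset≤μ , μ≤)) rewrite dec-true (μ % p ≟ a % p) μ%p≡a%p =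
    μ≡ , ≤-<-trans digit≤m∸1 m∸1<m
    where
    X = μ / p
    Y = offset / p
    μ≡ : μ ≡ p * (X ∸ Y) + offset
    μ≡ = begin
      μ                              ≡⟨ m≡m%n+[m/n]*n μ p ⟩
      μ % p + X * p
        ≡⟨ cong₂ (λ u v → u + v * p) (trans μ%p≡a%p (sym offset%p)) (sym (m+[n∸m]≡n (/-monoˡ-≤ p offset≤μ))) ⟩
      offset % p + (Y + (X ∸ Y)) * p     ≡⟨ regroup p (X ∸ Y) (offset % p) Y ⟩
      p * (X ∸ Y) + (offset % p + Y * p) ≡⟨ cong (p * (X ∸ Y) +_) (m≡m%n+[m/n]*n offset p) ⟨
      p * (X ∸ Y) + offset               ∎
      where
      open ≡-Reasoning
      regroup : ∀ p z x y → x + (y + z) * p ≡ p * z + (x + y * p)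
      regroup = solve-∀
    digit≤m∸1 : X ∸ Y ≤ m ∸ 1
    digit≤m∸1 = *-cancelˡ-≤ p (+-cancelʳ-≤ offset _ _
      (subst (_≤ p * (m ∸ 1) + offset) μ≡ (subst (μ ≤_) (+-comm offset (p * (m ∸ 1))) μ≤)))

  digits⇒good : ∀ e s → s < m → Good p r a m (p * s + offsetIf e) × inOffsetClass (p * s + offsetIf e) ≡ e
  digits⇒good false s s<m =
    inj₁ (μ%p≡0 , subst (_≤ p * (m ∸ 1)) (sym (+-identityʳ _)) (*-monoʳ-≤ p (<m⇒≤m∸1 s<m)))
    , dec-false (_ ≟ a % p) (λ e → a%p≢0 (trans (sym e) μ%p≡0))
    where
    μ%p≡0 : (p * s + 0) % p ≡ 0
    μ%p≡0 = trans (%-congˡ (trans (+-identityʳ _) (*-comm p s))) (m*n%n≡0 s p)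
  digits⇒good true s s<m = inj₂ (μ%p≡a%p , m≤n+m offset (p * s) , μ≤) , dec-true (_ ≟ a % p) μ%p≡a%p
    where
    regroup : ∀ p s r a → p * s + (p * r + a) ≡ a + (s + r) * p
    regroup = solve-∀
    μ%p≡a%p : (p * s + offset) % p ≡ a % p
    μ%p≡a%p = trans (%-congˡ (regroup p s r a)) ([m+kn]%n≡m%n a (s + r) p)
    μ≤ : p * s + offset ≤ offset + p * (m ∸ 1)
    μ≤ = subst (_≤ offset + p * (m ∸ 1)) (+-comm offset (p * s)) (+-monoʳ-≤ offset (*-monoʳ-≤ p (<m⇒≤m∸1 s<m)))

  digits-injective : ∀ {μ ν} → Good p r a m μ → Good p r a m ν →
    inOffsetClass μ ≡ inOffsetClass ν → digit μ ≡ digit ν → μ ≡ ν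
  digits-injective gμ gν e s =
    trans (proj₁ (good⇒digits gμ)) (trans (cong₂ (λ u v → p * u + offsetIf v) s e) (sym (proj₁ (good⇒digits gν))))

  digit-digits : ∀ e s → s < m → digit (p * s + offsetIf e) ≡ s
  digit-digits e s s<m with digits⇒good e s s<m
  ... | good , class≡e = *-cancelˡ-≡ _ s p (+-cancelʳ-≡ (offsetIf e) _ _ (sym μ≡))
    where
    μ = p * s + offsetIf e
    μ≡ : μ ≡ p * digit μ + offsetIf e
    μ≡ = subst (λ c → μ ≡ p * digit μ + offsetIf c) class≡e (proj₁ (good⇒digits good))

  addPartIf : Bool → ℕ → List ℕ → List ℕ
  addPartIf true  j D = j ∷ D
  addPartIf false j D = D

  Code : Set
  Code = List ℕ × List ℕ

  extend : ℕ → ℕ → Code → Code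
  extend j μ (D , S) = addPartIf (inOffsetClass μ) j D , digit μ ∷ S

  -- codes k n follows the recursion of partsLE k n: a partition into parts ≤ k
  -- with admissible multiplicities is recorded by the strict partition of those
  -- parts whose multiplicity lies in the offset class, and the digits of all
  -- multiplicities (of the part sizes k, k - 1, ..., 1).
  mutual
    codes : ℕ → ℕ → List Code
    codes zero    zero    = [ ([] , []) ]
    codes zero    (suc _) = []
    codes (suc k) n       = concatMap (codesWith k n) (filter (λ μ → μ * suc k ≤? n) (upTo (suc n)))

    codesWith : ℕ → ℕ → ℕ → List Code
    codesWith k n μ with good? p r a m μ
    ... | yes _ = map (extend (suc k) μ) (codes k (n ∸ μ * suc k))
    ... | no  _ = []

  module _ {X : Set} {P : X → Set} (P? : Decidable P) where

    length-filter-concatMap : ∀ {Y Z : Set} (f : Y → List X) (g : Y → List Z) ys →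
      (∀ y → length (filter P? (f y)) ≡ length (g y)) → length (filter P? (concatMap f ys)) ≡ length (concatMap g ys)
    length-filter-concatMap f g []       _ = refl
    length-filter-concatMap f g (y ∷ ys) h = begin
      length (filter P? (f y ++ concatMap f ys))                  ≡⟨ cong length (filter-++ P? (f y) (concatMap f ys)) ⟩
      length (filter P? (f y) ++ filter P? (concatMap f ys))      ≡⟨ length-++ (filter P? (f y)) ⟩
      length (filter P? (f y)) + length (filter P? (concatMap f ys)) ≡⟨ cong₂ _+_ (h y) (length-filter-concatMap f g ys h) ⟩
      length (g y) + length (concatMap g ys)                      ≡⟨ length-++ (g y) ⟨
      length (g y ++ concatMap g ys)                              ∎
      where open ≡-Reasoning

    length-filter-map : ∀ {Y : Set} {Q : Y → Set} (h : Y → X) (Q? : Decidable Q) ys →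
      (∀ {y} → y ∈ ys → P (h y) ⇔ Q y) → length (filter P? (map h ys)) ≡ length (filter Q? ys)
    length-filter-map h Q? []       _ = refl
    length-filter-map h Q? (y ∷ ys) e with P? (h y) | Q? y
    ... | yes _   | yes _  = cong suc (length-filter-map h Q? ys (e ∘ there))
    ... | no  _   | no  _  = length-filter-map h Q? ys (e ∘ there)
    ... | yes php | no ¬q  = ⊥-elim (¬q (Equivalence.to (e (here refl)) php))
    ... | no ¬ph  | yes q  = ⊥-elim (¬ph (Equivalence.from (e (here refl)) q))

    length-filter-none : ∀ {Y : Set} (h : Y → X) ys → (∀ {y} → y ∈ ys → ¬ P (h y)) →
      length (filter P? (map h ys)) ≡ 0
    length-filter-none h []       _ = refl
    length-filter-none h (y ∷ ys) e with P? (h y)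
    ... | yes ph = ⊥-elim (e (here refl) ph)
    ... | no  _  = length-filter-none h ys (e ∘ there)

  mult-++ : ∀ j X Y → mult j (X ++ Y) ≡ mult j X + mult j Y
  mult-++ j X Y = trans (cong length (filter-++ (_≟ j) X Y)) (length-++ (filter (_≟ j) X))

  mult-replicate-self : ∀ j μ → mult j (replicate μ j) ≡ μ
  mult-replicate-self j zero    = refl
  mult-replicate-self j (suc μ) = trans (cong length (filter-accept (_≟ j) refl)) (cong suc (mult-replicate-self j μ))

  mult-replicate-other : ∀ i j μ → i ≢ j → mult i (replicate μ j) ≡ 0
  mult-replicate-other i j zero    _   = refl
  mult-replicate-other i j (suc μ) i≢j =
    trans (cong length (filter-reject (_≟ i) (i≢j ∘ sym))) (mult-replicate-other i j μ i≢j)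

  mult-absent : ∀ j Y → All (_< j) Y → mult j Y ≡ 0
  mult-absent j []      []           = refl
  mult-absent j (y ∷ Y) (y<j ∷ Y<j) = trans (cong length (filter-reject (_≟ j) (<⇒≢ y<j))) (mult-absent j Y Y<j)

  mult-replicate++-self : ∀ μ j Y → All (_< j) Y → mult j (replicate μ j ++ Y) ≡ μ
  mult-replicate++-self μ j Y Y<j =
    trans (mult-++ j (replicate μ j) Y) (trans (cong₂ _+_ (mult-replicate-self j μ) (mult-absent j Y Y<j)) (+-identityʳ μ))

  mult-replicate++-below : ∀ μ i j Y → i < j → mult i (replicate μ j ++ Y) ≡ mult i Y
  mult-replicate++-below μ i j Y i<j =
    trans (mult-++ i (replicate μ j) Y) (cong (_+ mult i Y) (mult-replicate-other i j μ (<⇒≢ i<j)))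

  0%p≡0 : 0 % p ≡ 0
  0%p≡0 = n≤0⇒n≡0 (m%n≤m 0 p)

  good-0 : Good p r a m 0
  good-0 = inj₁ (0%p≡0 , z≤n)

  admissible-replicate++⁻ : ∀ μ j Y → All (_< j) Y → Admissible p r a m (replicate μ j ++ Y) →
    Good p r a m μ × Admissible p r a m Y
  admissible-replicate++⁻ zero    j Y Y<j adm = good-0 , adm
  admissible-replicate++⁻ (suc μ) j Y Y<j adm with ++⁻ (replicate (suc μ) j) adm
  ... | adm-j , adm-Y =
    subst (Good p r a m) (mult-replicate++-self (suc μ) j Y Y<j) (replicate⁻ adm-j) ,
    All.zipWith (λ (good-i , i<j) → subst (Good p r a m) (mult-replicate++-below (suc μ) _ j Y i<j) good-i) (adm-Y , Y<j)

  admissible-replicate++⁺ : ∀ μ j Y → All (_< j) Y → Good p r a m μ → Admissible p r a m Y →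
    Admissible p r a m (replicate μ j ++ Y)
  admissible-replicate++⁺ μ j Y Y<j good adm =
    ++⁺ (replicate⁺ μ (subst (Good p r a m) (sym (mult-replicate++-self μ j Y Y<j)) good))
        (All.zipWith (λ (good-i , i<j) → subst (Good p r a m) (sym (mult-replicate++-below μ _ j Y i<j)) good-i) (adm , Y<j))

  partsLE-bounded : ∀ k n {Y} → Y ∈ partsLE k n → All (_≤ k) Y
  partsLE-bounded zero    zero (here refl) = []
  partsLE-bounded (suc k) n    Y∈
    with find (∈-concatMap⁻ (λ μ → map (replicate μ (suc k) ++_) (partsLE k (n ∸ μ * suc k)))
                            {xs = filter (λ μ → μ * suc k ≤? n) (upTo (suc n))} Y∈)
  ... | μ , _ , Y∈μ with ∈-map⁻ (replicate μ (suc k) ++_) Y∈μ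
  ...   | Y′ , Y′∈ , refl = ++⁺ (replicate⁺ μ ≤-refl) (All.map m≤n⇒m≤1+n (partsLE-bounded k _ Y′∈))

  count-admissible : ∀ k n → length (filter (admissible? p r a m) (partsLE k n)) ≡ length (codes k n)
  count-admissible zero    zero    = refl
  count-admissible zero    (suc n) = refl
  count-admissible (suc k) n =
    length-filter-concatMap (admissible? p r a m) (λ μ → map (replicate μ (suc k) ++_) (partsLE k (n ∸ μ * suc k)))
                            (codesWith k n) (filter (λ μ → μ * suc k ≤? n) (upTo (suc n))) count-with
    where
    count-with : ∀ μ → length (filter (admissible? p r a m) (map (replicate μ (suc k) ++_) (partsLE k (n ∸ μ * suc k))))
                     ≡ length (codesWith k n μ)
    count-with μ with good? p r a m μ
    ... | yes good = begin
      length (filter (admissible? p r a m) (map (replicate μ (suc k) ++_) (partsLE k n′)))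
        ≡⟨ length-filter-map (admissible? p r a m) (replicate μ (suc k) ++_) (admissible? p r a m) (partsLE k n′)
             (λ Y∈ → mk⇔ (proj₂ ∘ admissible-replicate++⁻ μ (suc k) _ (below Y∈))
                         (admissible-replicate++⁺ μ (suc k) _ (below Y∈) good)) ⟩
      length (filter (admissible? p r a m) (partsLE k n′))   ≡⟨ count-admissible k n′ ⟩
      length (codes k n′)                                    ≡⟨ length-map (extend (suc k) μ) (codes k n′) ⟨
      length (map (extend (suc k) μ) (codes k n′))           ∎
      where
      open ≡-Reasoning
      n′ = n ∸ μ * suc k
      below : ∀ {Y} → Y ∈ partsLE k n′ → All (_< suc k) Y
      below Y∈ = All.map s≤s (partsLE-bounded k n′ Y∈)
    ... | no ¬good = length-filter-none (admissible? p r a m) (replicate μ (suc k) ++_) (partsLE k (n ∸ μ * suc k))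
      (λ Y∈ adm → ¬good (proj₁ (admissible-replicate++⁻ μ (suc k) _ (All.map s≤s (partsLE-bounded k _ Y∈)) adm)))

  Head≤ : ℕ → List ℕ → Set
  Head≤ k []      = ⊤
  Head≤ k (x ∷ _) = x ≤ k

  weight : List ℕ → ℕ
  weight []      = 0
  weight (s ∷ S) = s * suc (length S) + weight S

  record IsCode (k n : ℕ) (D S : List ℕ) : Set where
    constructor isCode
    field
      strict        : Strict D
      head≤         : Head≤ k D
      length-digits : length S ≡ k
      digits<m      : All (_< m) S
      size          : offset * sum D + p * weight S ≡ n

  codesWith-member : ∀ k n μ {x} → x ∈ codesWith k n μ →
    Good p r a m μ × ∃[ y ] y ∈ codes k (n ∸ μ * suc k) × x ≡ extend (suc k) μ y
  codesWith-member k n μ x∈ with good? p r a m μ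
  ... | yes good = good , ∈-map⁻ (extend (suc k) μ) x∈

  size-extend : ∀ e k D s S → length S ≡ k →
    offset * sum (addPartIf e (suc k) D) + p * weight (s ∷ S) ≡ (p * s + offsetIf e) * suc k + (offset * sum D + p * weight S)
  size-extend true  k D s S refl = regroup offset (suc (length S)) (sum D) p s (weight S)
    where
    regroup : ∀ c j σ p s w → c * (j + σ) + p * (s * j + w) ≡ (p * s + c) * j + (c * σ + p * w)
    regroup = solve-∀
  size-extend false k D s S refl = regroup offset (suc (length S)) (sum D) p s (weight S)
    where
    regroup : ∀ c j σ p s w → c * σ + p * (s * j + w) ≡ (p * s + 0) * j + (c * σ + p * w)
    regroup = solve-∀

  isCode-extend : ∀ {k n μ D S} → Good p r a m μ → IsCode k n D S →
    IsCode (suc k) (μ * suc k + n) (addPartIf (inOffsetClass μ) (suc k) D) (digit μ ∷ S)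
  isCode-extend {k} {n} {μ} {D} {S} good (isCode st head len digits size) =
    isCode (strict-add (inOffsetClass μ) D st head) (head-add (inOffsetClass μ) D head) (cong suc len)
           (proj₂ (good⇒digits good) ∷ digits)
           (trans (size-extend (inOffsetClass μ) k D (digit μ) S len)
                  (cong₂ (λ u v → u * suc k + v) (sym (proj₁ (good⇒digits good))) size))
    where
    strict-add : ∀ e D → Strict D → Head≤ k D → Strict (addPartIf e (suc k) D)
    strict-add true  []      _  _    = single (s≤s z≤n)
    strict-add true  (d ∷ D) st d≤k  = cons (s≤s d≤k) st
    strict-add false D       st _    = st
    head-add : ∀ e D → Head≤ k D → Head≤ (suc k) (addPartIf e (suc k) D)
    head-add true  D       _   = ≤-refl
    head-add false []      _   = tt
    head-add false (d ∷ D) d≤k = m≤n⇒m≤1+n d≤k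

  codes-sound : ∀ k n {D S} → (D , S) ∈ codes k n → IsCode k n D S
  codes-sound zero    zero (here refl) = isCode nil tt refl [] (cong₂ _+_ (*-zeroʳ offset) (*-zeroʳ p))
  codes-sound (suc k) n    x∈
    with find (∈-concatMap⁻ (codesWith k n) {xs = filter (λ μ → μ * suc k ≤? n) (upTo (suc n))} x∈)
  ... | μ , μ∈ , x∈μ with codesWith-member k n μ x∈μ
  ...   | good , (D , S) , y∈ , refl =
    subst (λ n → IsCode (suc k) n _ _) (m+[n∸m]≡n fits) (isCode-extend good (codes-sound k _ y∈))
    where
    fits = proj₂ (∈-filter⁻ (λ μ → μ * suc k ≤? n) {xs = upTo (suc n)} μ∈)

  peelTop : ∀ k D → Strict D → Head≤ (suc k) D →
    ∃[ e ] ∃[ D′ ] D ≡ addPartIf e (suc k) D′ × Strict D′ × Head≤ k D′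
  peelTop k []      _  _     = false , [] , refl , nil , tt
  peelTop k (d ∷ D) st d≤1+k with d ≟ suc k
  ... | yes refl = true , D , refl , strict-tail st , head-tail D st
    where
    head-tail : ∀ D → Strict (suc k ∷ D) → Head≤ k D
    head-tail []      _          = tt
    head-tail (_ ∷ _) (cons d<1+k _) = s≤s⁻¹ d<1+k
  ... | no d≢1+k = false , d ∷ D , refl , st , s≤s⁻¹ (≤∧≢⇒< d≤1+k d≢1+k)

  codesWith-extend : ∀ k n μ {y} → Good p r a m μ → y ∈ codes k (n ∸ μ * suc k) →
    extend (suc k) μ y ∈ codesWith k n μ
  codesWith-extend k n μ good y∈ with good? p r a m μ
  ... | yes _    = ∈-map⁺ (extend (suc k) μ) y∈
  ... | no ¬good = ⊥-elim (¬good good)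

  codes-complete : ∀ k n {D S} → IsCode k n D S → (D , S) ∈ codes k n
  codes-complete zero    n {[]}    {[]}    (isCode _ _ _ _ size) =
    subst (λ n → ([] , []) ∈ codes zero n) (trans (sym (cong₂ _+_ (*-zeroʳ offset) (*-zeroʳ p))) size) (here refl)
  codes-complete zero    n {d ∷ D} {[]}    (isCode st d≤0 _ _ _) with ≤-trans (strict-head-pos st) d≤0
  ... | ()
  codes-complete (suc k) n {D}     {s ∷ S} (isCode st head len (s<m ∷ digits) size) with peelTop k D st head
  ... | e , D′ , refl , st′ , head′ =
    ∈-concatMap⁺ (codesWith k n) (lose μ∈ (subst (_∈ codesWith k n μ) extend≡ (codesWith-extend k n μ good y∈)))
    where
    μ  = p * s + offsetIf e
    n′ = offset * sum D′ + p * weight S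
    good     = proj₁ (digits⇒good e s s<m)
    len′ = suc-injective len
    n≡ : n ≡ μ * suc k + n′
    n≡ = trans (sym size) (size-extend e k D′ s S len′)
    fits : μ * suc k ≤ n
    fits = subst (μ * suc k ≤_) (sym n≡) (m≤m+n (μ * suc k) n′)
    μ∈ : μ ∈ filter (λ μ → μ * suc k ≤? n) (upTo (suc n))
    μ∈ = ∈-filter⁺ (λ μ → μ * suc k ≤? n) (∈-upTo⁺ (s≤s (≤-trans (m≤m*n μ (suc k)) fits))) fits
    y∈ : (D′ , S) ∈ codes k (n ∸ μ * suc k)
    y∈ = subst (λ n → (D′ , S) ∈ codes k n) (sym (trans (cong (_∸ μ * suc k) n≡) (m+n∸m≡n (μ * suc k) n′)))
               (codes-complete k n′ (isCode st′ head′ len′ digits refl))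
    extend≡ : extend (suc k) μ (D′ , S) ≡ (addPartIf e (suc k) D′ , s ∷ S)
    extend≡ = cong₂ (λ c d → addPartIf c (suc k) D′ , d ∷ S) (proj₂ (digits⇒good e s s<m)) (digit-digits e s s<m)

  Unique-concatMap : ∀ {X Y : Set} (g : X → List Y) {xs} → Unique xs → (∀ x → Unique (g x)) →
    (∀ {x x′ y} → y ∈ g x → y ∈ g x′ → x ≡ x′) → Unique (concatMap g xs)
  Unique-concatMap g u unique-g disjoint =
    Unique.concat⁺ (All.map⁺ (All.universal unique-g _))
                   (AllPairs.map⁺ (AllPairs.map (λ x≢x′ {_} (y∈ , y∈′) → x≢x′ (disjoint y∈ y∈′)) u))

  addPartIf-injective : ∀ e j {D D′} → addPartIf e j D ≡ addPartIf e j D′ → D ≡ D′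
  addPartIf-injective true  j = ∷-injectiveʳ
  addPartIf-injective false j = id

  addPartIf-injectiveˡ : ∀ e e′ k {D D′} → Head≤ k D → Head≤ k D′ →
    addPartIf e (suc k) D ≡ addPartIf e′ (suc k) D′ → e ≡ e′
  addPartIf-injectiveˡ true  true  k _    _    _ = refl
  addPartIf-injectiveˡ false false k _    _    _ = refl
  addPartIf-injectiveˡ true  false k {D′ = _ ∷ _} _ d′≤k e = ⊥-elim (<-irrefl (sym (∷-injectiveˡ e)) (s≤s d′≤k))
  addPartIf-injectiveˡ false true  k {D = _ ∷ _}  d≤k _ e  = ⊥-elim (<-irrefl (∷-injectiveˡ e) (s≤s d≤k))

  extend-injective : ∀ j μ {x y} → extend j μ x ≡ extend j μ y → x ≡ y
  extend-injective j μ e = cong₂ _,_ (addPartIf-injective (inOffsetClass μ) j (cong proj₁ e)) (∷-injectiveʳ (cong proj₂ e))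

  codes-unique : ∀ k n → Unique (codes k n)
  codes-unique zero    zero    = [] ∷ []
  codes-unique zero    (suc n) = []
  codes-unique (suc k) n =
    Unique-concatMap (codesWith k n) (Unique.filter⁺ (λ μ → μ * suc k ≤? n) (Unique.upTo⁺ (suc n)))
                     codesWith-unique codesWith-disjoint
    where
    codesWith-unique : ∀ μ → Unique (codesWith k n μ)
    codesWith-unique μ with good? p r a m μ
    ... | yes _ = Unique.map⁺ (extend-injective (suc k) μ) (codes-unique k _)
    ... | no  _ = []
    codesWith-disjoint : ∀ {μ ν x} → x ∈ codesWith k n μ → x ∈ codesWith k n ν → μ ≡ ν
    codesWith-disjoint {μ} {ν} x∈μ x∈ν with codesWith-member k n μ x∈μ | codesWith-member k n ν x∈ν
    ... | good-μ , (D₁ , S₁) , y₁∈ , refl | good-ν , (D₂ , S₂) , y₂∈ , e =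
      digits-injective good-μ good-ν
        (addPartIf-injectiveˡ _ _ k (IsCode.head≤ (codes-sound k _ y₁∈)) (IsCode.head≤ (codes-sound k _ y₂∈))
                              (cong proj₁ e))
        (∷-injectiveˡ (cong proj₂ e))

  1≤offset : 1 ≤ offset
  1≤offset = ≤-trans (n≢0⇒n>0 a≢0) (m≤n+m a (p * r))
    where
    a≢0 : a ≢ 0
    a≢0 refl = a%p≢0 0%p≡0

  head≤-sum : ∀ D → Head≤ (sum D) D
  head≤-sum []      = tt
  head≤-sum (x ∷ D) = m≤m+n x (sum D)

  head≤-mono : ∀ {k k′} D → k ≤ k′ → Head≤ k D → Head≤ k′ D
  head≤-mono []      _    _   = tt
  head≤-mono (x ∷ D) k≤k′ x≤k = ≤-trans x≤k k≤k′

  franklinCode : Code → Code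
  franklinCode (D , S) = franklin D , S

  _≟Code_ : DecidableEquality Code
  _≟Code_ = ×.≡-dec (List.≡-dec _≟_) (List.≡-dec _≟_)

  franklinCode-fixedPointFree : ∀ N → (∀ σ w → offset * σ + p * w ≡ N → ¬ Pentagonal σ) →
    FixedPointFreeInvolutionOn franklinCode (codes N N)
  franklinCode-fixedPointFree N noPentagonal = record
    { closed         = closed
    ; involutive     = λ { {D , S} x∈ → cong (_, S) (FranklinAt.involutive (franklinAt-code x∈)) }
    ; no-fixed-point = λ { {D , S} x∈ fixed → noPentagonal (sum D) (weight S) (IsCode.size (codes-sound N N x∈))
                                                (FranklinAt.fixed⇒pentagonal (franklinAt-code x∈) (cong proj₁ fixed)) }
    }
    where
    franklinAt-code : ∀ {D S} → (D , S) ∈ codes N N → FranklinAt D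
    franklinAt-code {D} x∈ = franklinAt D (IsCode.strict (codes-sound N N x∈))
    closed : ∀ {x} → x ∈ codes N N → franklinCode x ∈ codes N N
    closed {D , S} x∈ with codes-sound N N x∈
    ... | isCode _ _ len digits size = codes-complete N N
          (isCode (FranklinAt.strict F) (head≤-mono (franklin D) sum≤N (head≤-sum (franklin D))) len digits
                  (trans (cong (λ σ → offset * σ + p * weight S) (FranklinAt.sum-franklin F)) size))
      where
      F = franklinAt-code x∈
      sum≤N : sum (franklin D) ≤ N
      sum≤N = begin
        sum (franklin D)               ≡⟨ FranklinAt.sum-franklin F ⟩
        sum D                          ≤⟨ m≤n*m (sum D) offset ⦃ >-nonZero 1≤offset ⦄ ⟩
        offset * sum D                 ≤⟨ m≤m+n (offset * sum D) (p * weight S) ⟩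
        offset * sum D + p * weight S  ≡⟨ size ⟩
        N                              ∎
        where open ≤-Reasoning

  b2-even : ∀ N → (∀ σ w → offset * σ + p * w ≡ N → ¬ Pentagonal σ) → 2 ∣ b2 r a m p N
  b2-even N noPentagonal = subst (2 ∣_) (sym (count-admissible N N))
    (fixedPointFree⇒even _≟Code_ (codes N N) (codes-unique N N) (franklinCode-fixedPointFree N noPentagonal))

open import Defs
open import Data.Nat using (ℕ; _<_; _≤_; NonZero)
open import Data.Nat.Divisibility using (_∣_)
open import Data.Nat.GCD using (gcd)
open import Data.Nat.Primality using (Prime)
open import Data.Integer using (ℤ; +_; _+_; _-_; _*_)
open import Data.Integer.Divisibility as ℤD using ()
open import Data.Product using (∃-syntax)
open import Relation.Nullary using (¬_)
open import Relation.Binary.PropositionalEquality using (_≡_)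
open import Data.Nat as ℕ using (z≤n; s≤s)
open import Data.Nat.Properties using (<⇒≢; <⇒≤; ≤-trans)
open import Data.Nat.Divisibility using (divides; ∣-refl; m%n≡0⇒n∣m)
open import Data.Nat.Coprimality using (gcd≡1⇒coprime)
open import Data.Integer using (-_; -[1+_])
open import Data.Integer.Properties using (pos-+; pos-*)
open import Data.Integer.Divisibility.Signed as ℤS using (∣ᵤ⇒∣; ∣⇒∣ᵤ; ∣m∣n⇒∣m+n; ∣m⇒∣m*n; ∣n⇒∣m*n)
open import Data.Integer.Tactic.RingSolver using (solve)
open import Data.List using ([]; _∷_)
open import Data.Product using (_,_)
open import Data.Sum using (inj₁; inj₂)
open import Relation.Binary.PropositionalEquality using (refl; sym; trans; cong; cong₂; subst; module ≡-Reasoning)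
open FranklinInvolution using (Pentagonal)

gcd≡1⇒%≢0 : ∀ {a p} .{{_ : NonZero p}} → 1 < p → gcd a p ≡ 1 → a % p ≢ 0
gcd≡1⇒%≢0 {a} {p} 1<p gcd≡1 a%p≡0 = <⇒≢ 1<p (sym (gcd≡1⇒coprime gcd≡1 (m%n≡0⇒n∣m a p a%p≡0 , ∣-refl)))

square-identity₁ : ∀ σ l → (+ 2) * σ + l ≡ (+ 3) * (l * l) →
  ((+ 6) * l - + 1) * ((+ 6) * l - + 1) ≡ (+ 24) * σ + + 1
square-identity₁ σ l h = begin
  ((+ 6) * l - + 1) * ((+ 6) * l - + 1)          ≡⟨ solve (l ∷ []) ⟩
  (+ 12) * ((+ 3) * (l * l)) - (+ 12) * l + + 1   ≡⟨ cong (λ z → (+ 12) * z - (+ 12) * l + + 1) h ⟨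
  (+ 12) * ((+ 2) * σ + l) - (+ 12) * l + + 1     ≡⟨ solve (σ ∷ l ∷ []) ⟩
  (+ 24) * σ + + 1                                ∎
  where open ≡-Reasoning

square-identity₂ : ∀ σ l → (+ 2) * σ ≡ (+ 3) * (l * l) + l →
  ((+ 6) * l + + 1) * ((+ 6) * l + + 1) ≡ (+ 24) * σ + + 1
square-identity₂ σ l h = begin
  ((+ 6) * l + + 1) * ((+ 6) * l + + 1)          ≡⟨ solve (l ∷ []) ⟩
  (+ 12) * ((+ 3) * (l * l) + l) + + 1            ≡⟨ cong (λ z → (+ 12) * z + + 1) h ⟨
  (+ 12) * ((+ 2) * σ) + + 1                      ≡⟨ solve (σ ∷ []) ⟩
  (+ 24) * σ + + 1                                ∎
  where open ≡-Reasoning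

pentagonal⇒square : ∀ σ → Pentagonal σ → ∃[ x ] x * x ≡ (+ 24) * (+ σ) + + 1
pentagonal⇒square σ (l , inj₁ h) = (+ 6) * (+ l) - + 1 , square-identity₁ (+ σ) (+ l) (begin
  (+ 2) * (+ σ) + + l      ≡⟨ cong (_+ + l) (pos-* 2 σ) ⟨
  + (2 ℕ.* σ ℕ.+ l)        ≡⟨ cong +_ h ⟩
  + (3 ℕ.* (l ℕ.* l))      ≡⟨ trans (pos-* 3 (l ℕ.* l)) (cong ((+ 3) *_) (pos-* l l)) ⟩
  (+ 3) * (+ l * + l)      ∎)
  where open ≡-Reasoning
pentagonal⇒square σ (l , inj₂ h) = (+ 6) * (+ l) + + 1 , square-identity₂ (+ σ) (+ l) (begin
  (+ 2) * (+ σ)             ≡⟨ pos-* 2 σ ⟨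
  + (2 ℕ.* σ)               ≡⟨ cong +_ h ⟩
  + (3 ℕ.* (l ℕ.* l) ℕ.+ l) ≡⟨ cong (_+ + l) (trans (pos-* 3 (l ℕ.* l)) (cong ((+ 3) *_) (pos-* l l))) ⟩
  (+ 3) * (+ l * + l) + + l ∎)
  where open ≡-Reasoning

discriminant-congruence : ∀ P R A σ w n t ainv → P ℤS.∣ A * ainv - + 1 → (P * R + A) * σ + P * w ≡ P * n + t →
  P ℤS.∣ ((+ 24) * σ + + 1) - ((+ 24) * t * ainv + + 1)
discriminant-congruence P R A σ w n t ainv P∣Aainv-1 size =
  subst (P ℤS.∣_) (sym difference≡)
    (∣m∣n⇒∣m+n (∣m⇒∣m*n ((+ 24) * ainv * (n - R * σ - w)) ℤS.∣-refl) (∣n⇒∣m*n (- ((+ 24) * σ)) P∣Aainv-1))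
  where
  open ≡-Reasoning
  t≡ : t ≡ (P * R + A) * σ + P * w - P * n
  t≡ = begin
    t                                ≡⟨ solve (P ∷ n ∷ t ∷ []) ⟩
    (P * n + t) - P * n              ≡⟨ cong (_- P * n) size ⟨
    (P * R + A) * σ + P * w - P * n  ∎
  difference≡ : ((+ 24) * σ + + 1) - ((+ 24) * t * ainv + + 1)
              ≡ P * ((+ 24) * ainv * (n - R * σ - w)) + (- ((+ 24) * σ)) * (A * ainv - + 1)
  difference≡ = begin
    ((+ 24) * σ + + 1) - ((+ 24) * t * ainv + + 1)
      ≡⟨ cong (λ t → ((+ 24) * σ + + 1) - ((+ 24) * t * ainv + + 1)) t≡ ⟩
    ((+ 24) * σ + + 1) - ((+ 24) * ((P * R + A) * σ + P * w - P * n) * ainv + + 1)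
      ≡⟨ solve (P ∷ R ∷ A ∷ σ ∷ w ∷ n ∷ ainv ∷ []) ⟩
    P * ((+ 24) * ainv * (n - R * σ - w)) + (- ((+ 24) * σ)) * (A * ainv - + 1)
      ∎

pos-size : ∀ p r a σ w → + ((p ℕ.* r ℕ.+ a) ℕ.* σ ℕ.+ p ℕ.* w) ≡ ((+ p) * (+ r) + + a) * (+ σ) + (+ p) * (+ w)
pos-size p r a σ w = trans (pos-+ ((p ℕ.* r ℕ.+ a) ℕ.* σ) (p ℕ.* w))
  (cong₂ _+_ (trans (pos-* (p ℕ.* r ℕ.+ a) σ) (cong (_* + σ) (trans (pos-+ (p ℕ.* r) a) (cong (_+ + a) (pos-* p r)))))
             (pos-* p w))

pentagonal⇒residue : ∀ p r a σ w n t ainv → (+ p) ℤD.∣ ((+ a) * ainv - + 1) →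
  + ((p ℕ.* r ℕ.+ a) ℕ.* σ ℕ.+ p ℕ.* w) ≡ (+ p) * (+ n) + t → Pentagonal σ →
  ∃[ x ] (+ p) ℤD.∣ (x * x - ((+ 24) * t * ainv + + 1))
pentagonal⇒residue p r a σ w n t ainv p∣aainv-1 size pentagonal with pentagonal⇒square σ pentagonal
... | x , x²≡24σ+1 = x , ∣⇒∣ᵤ (subst (λ y → (+ p) ℤS.∣ y - ((+ 24) * t * ainv + + 1)) (sym x²≡24σ+1)
  (discriminant-congruence (+ p) (+ r) (+ a) (+ σ) (+ w) (+ n) t ainv (∣ᵤ⇒∣ p∣aainv-1)
    (trans (sym (pos-size p r a σ w)) size)))

theorem6 : (p a r m : ℕ) → .{{_ : NonZero p}} → Prime p → 3 < p → 1 ≤ a → gcd a p ≡ 1 → 1 ≤ m →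
    (ainv : ℤ) → (+ p) ℤD.∣ ((+ a) * ainv - + 1) →
    (t : ℤ) → ¬ (∃[ x ] ((+ p) ℤD.∣ (x * x - ((+ 24) * t * ainv + + 1)))) →
    (n : ℕ) → 2 ∣ b2ℤ r a m p ((+ p) * (+ n) + t)
theorem6 p a r m _ 3<p _ gcd≡1 1≤m ainv p∣aainv-1 t nonresidue n with (+ p) * (+ n) + t in pn+t≡N
... | -[1+ _ ] = divides 0 refl
... | + N = b2-even N λ σ w size pentagonal →
  nonresidue (pentagonal⇒residue p r a σ w n t ainv p∣aainv-1 (trans (cong +_ size) (sym pn+t≡N)) pentagonal)
  where open Encoding p r a m (gcd≡1⇒%≢0 (≤-trans (s≤s (s≤s z≤n)) (<⇒≤ 3<p)) gcd≡1) 1≤m
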